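{- Let $\Gamma$ be a weighted digraph with Laplacian matrix $L$ and matrices $Q_k$, $Q(\tau)$ as in the context. Then for every $k=0,1,2,\dots$, the matrix $Q_k$ commutes with every $n\times n$ matrix that commutes with $L$; in particular, $Q_k$ commutes with $L$, with $Q(\tau)$ for every $\tau$, and with $Q_m$ for every $m\ge0$.
   Context: $\Gamma$ is a weighted digraph without loops on vertex set $\{1,\dots,n\}$, $n>1$, with strictly positive arc weights $w_{ij}$ ($w_{ij}=0$ if there is no arc $i\to j$). Its Laplacian $L=(\ell_{ij})$ has $\ell_{ij}=-w_{ij}$ for $j\ne i$, $\ell_{ii}=\sum_{k\ne i}w_{ik}$. The weight of a subgraph is the product of its arc weights (1 if no arcs); the weight of a set of subgraphs is the sum of their weights (0 if empty). A converging tree is a weakly connected digraph in which one vertex (the root) has outdegree 0 and all others outdegree 1; an in-forest of $\Gamma$ is a spanning subgraph all of whose weak components are converging trees. $d$ is the minimum number of trees in an in-forest of $\Gamma$. For $k\ge0$, $Q_k=(q^k_{ij})$ where $q^k_{ij}$ is the total weight of in-forests of $\Gamma$ with $k$ arcs in which $i$ belongs to the tree rooted at $j$; $Q(\tau)=\sum_{k=0}^{n-d}Q_k\tau^k$ for $\tau\in\mathbb R$. -}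

module Defs where

open import Level using (Level)
open import Algebra.Bundles using (CommutativeRing)
open import Data.Nat using (ℕ; zero; suc) renaming (_⊔_ to _⊔ℕ_; _⊓_ to _⊓ℕ_)
open import Data.Fin using (Fin) renaming (_≟_ to _≟ᶠ_)
open import Data.Bool using (Bool; true; false; _∧_; if_then_else_)
open import Data.Maybe using (Maybe; just; nothing; is-just)
open import Data.List using (List; []; _∷_; map; concatMap; filter; foldr; allFin)
open import Data.Vec.Functional using (Vector) renaming (_∷_ to _∷ᵥ_)
open import Relation.Nullary using (does)
open import Relation.Binary.PropositionalEquality using (_≡_)
open import Relation.Nullary.Decidable using (yes; no)

allFuns : ∀ {a} {A : Set a} → List A → (m : ℕ) → List (Fin m → A)
allFuns as zero = (λ ()) ∷ []
allFuns as (suc m) = concatMap (λ x → map (λ g → x ∷ᵥ g) (allFuns as m)) as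

-- A weighted digraph on {0,…,n-1} with entries of a commutative ring:
--   Arc i j = true  iff there is an arc i → j,  w i j = its weight.
module Digraph {c ℓ : Level} (R : CommutativeRing c ℓ) (n : ℕ)
               (Arc : Fin n → Fin n → Bool) (w : Fin n → Fin n → CommutativeRing.Carrier R) where

  open CommutativeRing R using (Carrier; _≈_; _+_; _*_; -_; 0#; 1#)

  Matrix : Set c
  Matrix = Fin n → Fin n → Carrier

  ∑ : ∀ {m} → (Fin m → Carrier) → Carrier
  ∑ {zero} f = 0#
  ∑ {suc m} f = f Fin.zero + ∑ (λ i → f (Fin.suc i))
    where import Data.Fin as Fin

  ∏ : ∀ {m} → (Fin m → Carrier) → Carrier
  ∏ {zero} f = 1#
  ∏ {suc m} f = f Fin.zero * ∏ (λ i → f (Fin.suc i))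
    where import Data.Fin as Fin

  _·_ : Matrix → Matrix → Matrix
  (A · B) i j = ∑ (λ k → A i k * B k j)

  _≈ₘ_ : Matrix → Matrix → Set ℓ
  A ≈ₘ B = ∀ i j → A i j ≈ B i j

  Commute : Matrix → Matrix → Set ℓ
  Commute A B = (A · B) ≈ₘ (B · A)

  _==_ : Fin n → Fin n → Bool
  i == j = does (i ≟ᶠ j)

  W : Fin n → Fin n → Carrier
  W i j = if Arc i j then w i j else 0#

  L : Matrix
  L i j = if i == j then ∑ (λ k → if k == i then 0# else W i k) else - W i j

  -- A spanning subgraph with outdegree ≤ 1 is given by its "parent" map:
  -- f i = just j  means the subgraph contains the arc i → j; nothing means i has outdegree 0.
  Parent : Set
  Parent = Fin n → Maybe (Fin n)

  allParents : List Parent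
  allParents = allFuns (nothing ∷ map just (allFin n)) n

  walk : Parent → ℕ → Fin n → Maybe (Fin n)
  walk f zero i = nothing
  walk f (suc m) i with f i
  ... | nothing = just i
  ... | just j = walk f m j

  arcOK : Fin n → Maybe (Fin n) → Bool
  arcOK i nothing = true
  arcOK i (just j) = Arc i j

  allB : ∀ {m} → (Fin m → Bool) → Bool
  allB {m} p = foldr (λ i b → p i ∧ b) true (allFin m)

  countB : ∀ {m} → (Fin m → Bool) → ℕ
  countB {m} p = foldr (λ i k → if p i then suc k else k) zero (allFin m)

  -- f is an in-forest of Γ: all arcs are arcs of Γ, and from every vertex the walk
  -- reaches a root (outdegree 0 vertex), i.e. there are no cycles; then every weak
  -- component is a converging tree.
  isInForest : Parent → Bool
  isInForest f = allB (λ i → arcOK i (f i) ∧ is-just (walk f n i))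

  inForests : List Parent
  inForests = filter (λ f → isInForest f ≟B true) allParents
    where open import Data.Bool.Properties renaming (_≟_ to _≟B_)

  numArcs : Parent → ℕ
  numArcs f = countB (λ i → is-just (f i))

  numTrees : Parent → ℕ
  numTrees f = countB (λ i → Data.Bool.not (is-just (f i)))
    where import Data.Bool

  arcWeight : Fin n → Maybe (Fin n) → Carrier
  arcWeight i nothing = 1#
  arcWeight i (just j) = w i j

  weight : Parent → Carrier
  weight f = ∏ (λ i → arcWeight i (f i))

  eqM : Maybe (Fin n) → Fin n → Bool
  eqM nothing j = false
  eqM (just r) j = r == j

  eqℕ : ℕ → ℕ → Bool
  eqℕ a b = does (a Data.Nat.≟ b)
    where import Data.Nat

  d : ℕ
  d = foldr (λ f m → numTrees f ⊓ℕ m) n inForests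

  Q : ℕ → Matrix
  Q k i j = foldr (λ f s → (if eqℕ (numArcs f) k ∧ eqM (walk f n i) j then weight f else 0#) + s)
                  0# inForests

  pow : Carrier → ℕ → Carrier
  pow τ zero = 1#
  pow τ (suc m) = τ * pow τ m

  Qτ : Carrier → Matrix
  Qτ τ i j = sumUpTo (n Data.Nat.∸ d)
    where
      import Data.Nat
      sumUpTo : ℕ → Carrier
      sumUpTo zero = Q zero i j
      sumUpTo (suc m) = sumUpTo m + Q (suc m) i j * pow τ (suc m)

{-# OPTIONS --safe #-}
-- Write σₖ for the total weight of the in-forests with k arcs. The matrices satisfy
--   Q₀ = σ₀ I   and   Qₖ₊₁ = σₖ₊₁ I − L Qₖ,
-- so each Qₖ is a polynomial in L and commutes with everything that commutes with L.
-- To check the (i, j) entry, classify forests by the arc leaving i. Removing it leaves a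
-- forest h in which i is a root; conversely, grafting the root i of h onto p gives a forest
-- exactly when i → p is an arc and p lies outside the tree of i, and the grafted tree then
-- takes the root of p. As L has no loops, (L Qₖ)ᵢⱼ = Σₘ wᵢₘ (qᵢⱼ − qₘⱼ). In this sum the
-- k-arc forests with a grafted i contribute Σₚ Σₘ aₚ aₘ (bₚ − bₘ) = 0, where aₓ is the weight
-- of i → x for x outside the tree of i and bₓ = [x lies in the tree of j]; what remains is
--   Σ { w(h) Σₘ wᵢₘ (δᵢⱼ − bₘ) : h has k arcs and i is a root of h },
-- which is also what the (k+1)-arc forests with a grafted i contribute to δᵢⱼ σₖ₊₁ − qᵏ⁺¹ᵢⱼ,
-- while those in which i is a root contribute δᵢⱼ − δᵢⱼ = 0.
module Submission where

open import Defs
open import Level using (Level)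
open import Algebra.Bundles using (CommutativeMonoid; Ring; CommutativeRing)
open import Data.Bool using (Bool; true; false; if_then_else_; _∧_; not)
open import Data.Fin using (Fin; zero; suc; _≟_; toℕ)
open import Data.List using (List; []; _∷_; _++_; map; concatMap; filter; foldr; allFin)
open import Data.List.Properties using (foldr-map; map-tabulate)
open import Data.Nat as ℕ using (ℕ; zero; suc; _∸_; _<_; _≤_; _<?_)
open import Data.Nat.GeneralisedArithmetic using (iterate)
open import Data.Nat.Induction using (<-rec; rec)
open import Data.Nat.Properties
  using (n<1+n; m<1+n⇒m≤n; m+[n∸m]≡n; +-monoˡ-<; <-≤-trans; ≤-reflexive; ≮⇒≥; ≤-trans)
open import Data.Fin.Properties using (pigeonhole; toℕ<n)
open import Data.Product using (_×_; _,_; ∃; ∃-syntax; proj₁; proj₂)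
open import Function using (_∘_; id)
open import Data.Empty using (⊥-elim)
open import Data.Maybe using (Maybe; just; nothing; fromMaybe; is-just)
open import Data.Maybe.Properties using (just-injective)
open import Data.Bool.Properties using (not-¬)
open import Relation.Nullary.Decidable using (dec-true; dec-false)
open import Relation.Binary.PropositionalEquality as ≡ using (_≡_; _≢_; _≗_)
open import Relation.Nullary using (does; yes; no; ¬_)
open import Relation.Binary.Bundles using (Setoid)
open import Relation.Binary.Core using (_Preserves_⟶_)
open import Data.Vec.Functional using (Vector; head; tail) renaming (_∷_ to _∷ᵥ_)
import Data.Vec.Functional.Relation.Binary.Equality.Setoid as VecSetoid
import Relation.Binary.Reasoning.Setoid as SetoidReasoning
open import Relation.Unary using (Pred; Decidable)

private
  variable
    a b : Level
    A : Set a
    B : Set b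

allFin-suc : ∀ m → allFin (suc m) ≡ zero ∷ map suc (allFin m)
allFin-suc m = ≡.cong (zero ∷_) (≡.sym (map-tabulate id suc))

foldr-allFin-suc : ∀ {m} (f : Fin (suc m) → B → B) e →
                   foldr f e (allFin (suc m)) ≡ f zero (foldr (f ∘ suc) e (allFin m))
foldr-allFin-suc {m = m} f e =
  ≡.trans (≡.cong (foldr f e) (allFin-suc m)) (≡.cong (f zero) (foldr-map f suc e (allFin m)))

-- Unlike `insertAt`, this computes by recursion on the position, so that
-- insert (x ∷ g) (suc i) v reduces to x ∷ insert g i v.
insert : ∀ {m} → Vector A m → Fin (suc m) → A → Vector A (suc m)
insert             g zero    v = v ∷ᵥ g
insert {m = suc m} g (suc i) v = head g ∷ᵥ insert (tail g) i v

insert-lookup : ∀ {m} (g : Vector A m) i v → insert g i v i ≡ v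
insert-lookup             g zero    v = ≡.refl
insert-lookup {m = suc m} g (suc i) v = insert-lookup (tail g) i v

insert-other : ∀ {m} (g : Vector A m) {i x} u v → i ≢ x → insert g i u x ≡ insert g i v x
insert-other             g {zero}  {zero}  u v i≢x = ⊥-elim (i≢x ≡.refl)
insert-other             g {zero}  {suc x} u v i≢x = ≡.refl
insert-other {m = suc m} g {suc i} {zero}  u v i≢x = ≡.refl
insert-other {m = suc m} g {suc i} {suc x} u v i≢x = insert-other (tail g) u v (i≢x ∘ ≡.cong suc)

iterate-+ : ∀ (g : A → A) x s t → iterate g x (s ℕ.+ t) ≡ iterate g (iterate g x s) t
iterate-+ g x zero    t = ≡.refl
iterate-+ g x (suc s) t = iterate-+ g (g x) s t

iterate-fixed : ∀ {g : A → A} {x} → g x ≡ x → ∀ t → iterate g x t ≡ x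
iterate-fixed gx≡x zero    = ≡.refl
iterate-fixed {g = g} {x} gx≡x (suc t) = ≡.trans (≡.cong (λ y → iterate g y t) gx≡x) (iterate-fixed gx≡x t)

iterate-shortcut : ∀ (g : A → A) x {s t} u → iterate g x s ≡ iterate g x t → t ≤ u →
                   iterate g x (s ℕ.+ (u ∸ t)) ≡ iterate g x u
iterate-shortcut g x {s} {t} u same t≤u = begin
  iterate g x (s ℕ.+ (u ∸ t))         ≡⟨ iterate-+ g x s (u ∸ t) ⟩
  iterate g (iterate g x s) (u ∸ t)   ≡⟨ ≡.cong (λ y → iterate g y (u ∸ t)) same ⟩
  iterate g (iterate g x t) (u ∸ t)   ≡⟨ iterate-+ g x t (u ∸ t) ⟨
  iterate g x (t ℕ.+ (u ∸ t))         ≡⟨ ≡.cong (iterate g x) (m+[n∸m]≡n t≤u) ⟩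
  iterate g x u                       ∎
  where open ≡.≡-Reasoning

-- By the pigeonhole principle the first m + 1 points of an orbit in Fin m
-- contain a repetition, which can be cut out of any longer path.
iterate-early : ∀ {m} (g : Fin m → Fin m) x t → ∃[ s ] s < m × iterate g x s ≡ iterate g x t
iterate-early {m} g x = <-rec _ early
  where
  early : ∀ t → (∀ {t′} → t′ < t → ∃[ s ] s < m × iterate g x s ≡ iterate g x t′) →
          ∃[ s ] s < m × iterate g x s ≡ iterate g x t
  early t shorter with t <? m
  ... | yes t<m = t , t<m , ≡.refl
  ... | no  t≮m with pigeonhole (n<1+n m) (λ a → iterate g x (toℕ a))
  ...   | a , b , a<b , same =
    let s , s<m , eq = shorter t′<t in s , s<m , ≡.trans eq (iterate-shortcut g x {toℕ a} t same b≤t)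
    where
    b≤t : toℕ b ≤ t
    b≤t = ≤-trans (m<1+n⇒m≤n (toℕ<n b)) (≮⇒≥ t≮m)
    t′<t : toℕ a ℕ.+ (t ∸ toℕ b) < t
    t′<t = <-≤-trans (+-monoˡ-< (t ∸ toℕ b) a<b) (≤-reflexive (m+[n∸m]≡n b≤t))

module ListSum {c ℓ} (M : CommutativeMonoid c ℓ) where
  open CommutativeMonoid M
    renaming ( _∙_ to _+_; ε to 0#; ∙-cong to +-cong; ∙-congˡ to +-congˡ
             ; assoc to +-assoc; identityˡ to +-identityˡ)
  open import Algebra.Properties.CommutativeSemigroup commutativeSemigroup using (interchange)
  open SetoidReasoning setoid

  ∑ˡ : List A → (A → Carrier) → Carrier
  ∑ˡ xs g = foldr (λ x s → g x + s) 0# xs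

  ∑ˡ-cong : ∀ (xs : List A) {g h} → (∀ x → g x ≈ h x) → ∑ˡ xs g ≈ ∑ˡ xs h
  ∑ˡ-cong []       g≈h = refl
  ∑ˡ-cong (x ∷ xs) g≈h = +-cong (g≈h x) (∑ˡ-cong xs g≈h)

  ∑ˡ-zero : ∀ (xs : List A) {g} → (∀ x → g x ≈ 0#) → ∑ˡ xs g ≈ 0#
  ∑ˡ-zero []       g≈0 = refl
  ∑ˡ-zero (x ∷ xs) g≈0 = trans (+-cong (g≈0 x) (∑ˡ-zero xs g≈0)) (+-identityˡ 0#)

  ∑ˡ-distrib-+ : ∀ (xs : List A) g h → ∑ˡ xs (λ x → g x + h x) ≈ ∑ˡ xs g + ∑ˡ xs h
  ∑ˡ-distrib-+ []       g h = sym (+-identityˡ 0#)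
  ∑ˡ-distrib-+ (x ∷ xs) g h = trans (+-congˡ (∑ˡ-distrib-+ xs g h)) (interchange _ _ _ _)

  ∑ˡ-comm : ∀ (xs : List A) (ys : List B) (g : A → B → Carrier) →
            ∑ˡ xs (λ x → ∑ˡ ys (g x)) ≈ ∑ˡ ys (λ y → ∑ˡ xs (λ x → g x y))
  ∑ˡ-comm []       ys g = sym (∑ˡ-zero ys (λ _ → refl))
  ∑ˡ-comm (x ∷ xs) ys g = trans (+-congˡ (∑ˡ-comm xs ys g)) (sym (∑ˡ-distrib-+ ys (g x) _))

  ∑ˡ-++ : ∀ (xs ys : List A) g → ∑ˡ (xs ++ ys) g ≈ ∑ˡ xs g + ∑ˡ ys g
  ∑ˡ-++ []       ys g = sym (+-identityˡ _)
  ∑ˡ-++ (x ∷ xs) ys g = trans (+-congˡ (∑ˡ-++ xs ys g)) (sym (+-assoc _ _ _))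

  ∑ˡ-map : ∀ (f : A → B) xs g → ∑ˡ (map f xs) g ≡ ∑ˡ xs (g ∘ f)
  ∑ˡ-map f xs g = foldr-map _ f 0# xs

  ∑ˡ-concatMap : ∀ (f : A → List B) xs g → ∑ˡ (concatMap f xs) g ≈ ∑ˡ xs (λ x → ∑ˡ (f x) g)
  ∑ˡ-concatMap f []       g = refl
  ∑ˡ-concatMap f (x ∷ xs) g = trans (∑ˡ-++ (f x) (concatMap f xs) g) (+-congˡ (∑ˡ-concatMap f xs g))

  ∑ˡ-filter : ∀ {p} {P : Pred A p} (P? : Decidable P) xs g →
              ∑ˡ (filter P? xs) g ≈ ∑ˡ xs (λ x → if does (P? x) then g x else 0#)
  ∑ˡ-filter P? []       g = refl
  ∑ˡ-filter P? (x ∷ xs) g with does (P? x)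
  ... | true  = +-congˡ (∑ˡ-filter P? xs g)
  ... | false = trans (∑ˡ-filter P? xs g) (sym (+-identityˡ _))

  ∑ˡ-allFin-suc : ∀ {m} (g : Fin (suc m) → Carrier) →
                  ∑ˡ (allFin (suc m)) g ≡ g zero + ∑ˡ (allFin m) (g ∘ suc)
  ∑ˡ-allFin-suc g = foldr-allFin-suc (λ x s → g x + s) 0#

  ∑ˡ-allFuns-suc : ∀ (vs : List A) m G →
                   ∑ˡ (allFuns vs (suc m)) G ≈ ∑ˡ vs (λ v → ∑ˡ (allFuns vs m) (λ g → G (v ∷ᵥ g)))
  ∑ˡ-allFuns-suc vs m G = trans (∑ˡ-concatMap (λ v → map (v ∷ᵥ_) (allFuns vs m)) vs G)
                                (∑ˡ-cong vs (λ v → reflexive (∑ˡ-map (v ∷ᵥ_) (allFuns vs m) G)))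

  ∑ˡ-allFuns-insert : ∀ (vs : List A) m (i : Fin (suc m)) G →
                      ∑ˡ (allFuns vs (suc m)) G ≈ ∑ˡ vs (λ v → ∑ˡ (allFuns vs m) (λ g → G (insert g i v)))
  ∑ˡ-allFuns-insert vs m       zero    G = ∑ˡ-allFuns-suc vs m G
  ∑ˡ-allFuns-insert vs (suc m) (suc i) G = begin
    ∑ˡ (allFuns vs (suc (suc m))) G
      ≈⟨ ∑ˡ-allFuns-suc vs (suc m) G ⟩
    ∑ˡ vs (λ x → ∑ˡ (allFuns vs (suc m)) (λ g → G (x ∷ᵥ g)))
      ≈⟨ ∑ˡ-cong vs (λ x → ∑ˡ-allFuns-insert vs m i (λ g → G (x ∷ᵥ g))) ⟩
    ∑ˡ vs (λ x → ∑ˡ vs (λ v → ∑ˡ (allFuns vs m) (λ g → G (x ∷ᵥ insert g i v))))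
      ≈⟨ ∑ˡ-comm vs vs _ ⟩
    ∑ˡ vs (λ v → ∑ˡ vs (λ x → ∑ˡ (allFuns vs m) (λ g → G (x ∷ᵥ insert g i v))))
      ≈⟨ ∑ˡ-cong vs (λ v → ∑ˡ-allFuns-suc vs m (λ g → G (insert g (suc i) v))) ⟨
    ∑ˡ vs (λ v → ∑ˡ (allFuns vs (suc m)) (λ g → G (insert g (suc i) v))) ∎

module RingListSum {c ℓ} (R : Ring c ℓ) where
  open Ring R
  open import Algebra.Properties.Ring R using (-0#≈0#; -‿+-comm)
  open ListSum +-commutativeMonoid public

  *-distribˡ-∑ˡ : ∀ (xs : List A) x g → x * ∑ˡ xs g ≈ ∑ˡ xs (λ y → x * g y)
  *-distribˡ-∑ˡ []       x g = zeroʳ x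
  *-distribˡ-∑ˡ (y ∷ ys) x g = trans (distribˡ x _ _) (+-congˡ (*-distribˡ-∑ˡ ys x g))

  ∑ˡ-distrib-- : ∀ (xs : List A) g h → ∑ˡ xs (λ x → g x - h x) ≈ ∑ˡ xs g - ∑ˡ xs h
  ∑ˡ-distrib-- xs g h = trans (∑ˡ-distrib-+ xs g (λ x → - h x)) (+-congˡ (∑ˡ-neg xs))
    where
    ∑ˡ-neg : ∀ ys → ∑ˡ ys (λ x → - h x) ≈ - ∑ˡ ys h
    ∑ˡ-neg []       = sym -0#≈0#
    ∑ˡ-neg (x ∷ xs) = trans (+-congˡ (∑ˡ-neg xs)) (-‿+-comm _ _)

-- Digraph's ∑ and _·_ do not use Arc and w; they are parameters only because Digraph takes them.
module MatrixAlgebra {c ℓ} (R : CommutativeRing c ℓ) (n : ℕ)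
                     (Arc : Fin n → Fin n → Bool) (w : Fin n → Fin n → CommutativeRing.Carrier R) where
  open CommutativeRing R hiding (zero)
  open import Algebra.Properties.Ring ring using ([y-z]x≈yx-zx; x[y-z]≈xy-xz)
  open RingListSum ring
  open Digraph R n Arc w
  open SetoidReasoning setoid
  open import Algebra.Properties.CommutativeSemigroup *-commutativeSemigroup using (x∙yz≈y∙xz; xy∙z≈xz∙y)

  ∑≡∑ˡ : ∀ {m} (f : Fin m → Carrier) → ∑ f ≡ ∑ˡ (allFin m) f
  ∑≡∑ˡ {zero}  f = ≡.refl
  ∑≡∑ˡ {suc m} f = ≡.trans (≡.cong (f zero +_) (∑≡∑ˡ (f ∘ suc))) (≡.sym (∑ˡ-allFin-suc f))

  module _ {m : ℕ} where
    ∑-cong : {f g : Fin m → Carrier} → (∀ i → f i ≈ g i) → ∑ f ≈ ∑ g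
    ∑-cong {f} {g} f≈g rewrite ∑≡∑ˡ f | ∑≡∑ˡ g = ∑ˡ-cong (allFin m) f≈g

    ∑-zero : {f : Fin m → Carrier} → (∀ i → f i ≈ 0#) → ∑ f ≈ 0#
    ∑-zero {f} f≈0 rewrite ∑≡∑ˡ f = ∑ˡ-zero (allFin m) f≈0

    ∑-distrib-+ : (f g : Fin m → Carrier) → ∑ (λ i → f i + g i) ≈ ∑ f + ∑ g
    ∑-distrib-+ f g rewrite ∑≡∑ˡ f | ∑≡∑ˡ g | ∑≡∑ˡ (λ i → f i + g i) =
      ∑ˡ-distrib-+ (allFin m) f g

    ∑-distrib-- : (f g : Fin m → Carrier) → ∑ (λ i → f i - g i) ≈ ∑ f - ∑ g
    ∑-distrib-- f g rewrite ∑≡∑ˡ f | ∑≡∑ˡ g | ∑≡∑ˡ (λ i → f i - g i) =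
      ∑ˡ-distrib-- (allFin m) f g

    *-distribˡ-∑ : ∀ x (f : Fin m → Carrier) → x * ∑ f ≈ ∑ (λ i → x * f i)
    *-distribˡ-∑ x f rewrite ∑≡∑ˡ f | ∑≡∑ˡ (λ i → x * f i) = *-distribˡ-∑ˡ (allFin m) x f

    *-distribʳ-∑ : ∀ x (f : Fin m → Carrier) → ∑ f * x ≈ ∑ (λ i → f i * x)
    *-distribʳ-∑ x f = trans (*-comm _ x) (trans (*-distribˡ-∑ x f) (∑-cong (λ i → *-comm x (f i))))

    ∑-∑ˡ-comm : ∀ {a} {A : Set a} (xs : List A) (g : Fin m → A → Carrier) →
                ∑ (λ i → ∑ˡ xs (g i)) ≈ ∑ˡ xs (λ x → ∑ (λ i → g i x))
    ∑-∑ˡ-comm xs g = begin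
      ∑ (λ i → ∑ˡ xs (g i))
        ≡⟨ ∑≡∑ˡ (λ i → ∑ˡ xs (g i)) ⟩
      ∑ˡ (allFin m) (λ i → ∑ˡ xs (g i))
        ≈⟨ ∑ˡ-comm (allFin m) xs g ⟩
      ∑ˡ xs (λ x → ∑ˡ (allFin m) (λ i → g i x))
        ≈⟨ ∑ˡ-cong xs (λ x → reflexive (≡.sym (∑≡∑ˡ (λ i → g i x)))) ⟩
      ∑ˡ xs (λ x → ∑ (λ i → g i x)) ∎

    ∑-comm : ∀ {k} (f : Fin m → Fin k → Carrier) → ∑ (λ i → ∑ (f i)) ≈ ∑ (λ j → ∑ (λ i → f i j))
    ∑-comm {k} f = begin
      ∑ (λ i → ∑ (f i))                         ≈⟨ ∑-cong (λ i → reflexive (∑≡∑ˡ (f i))) ⟩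
      ∑ (λ i → ∑ˡ (allFin k) (f i))             ≈⟨ ∑-∑ˡ-comm (allFin k) f ⟩
      ∑ˡ (allFin k) (λ j → ∑ (λ i → f i j))     ≡⟨ ≡.sym (∑≡∑ˡ (λ j → ∑ (λ i → f i j))) ⟩
      ∑ (λ j → ∑ (λ i → f i j))                 ∎

  ∑-δˡ : ∀ {m} (i : Fin m) (f : Fin m → Carrier) → ∑ (λ t → if does (i ≟ t) then f t else 0#) ≈ f i
  ∑-δˡ {suc m} zero    f = trans (+-congˡ (∑-zero {m} (λ _ → refl))) (+-identityʳ _)
  ∑-δˡ {suc m} (suc i) f = trans (+-identityˡ _) (∑-δˡ i (f ∘ suc))

  ∑-δʳ : ∀ {m} (i : Fin m) (f : Fin m → Carrier) → ∑ (λ t → if does (t ≟ i) then f t else 0#) ≈ f i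
  ∑-δʳ {suc m} zero    f = trans (+-congˡ (∑-zero {m} (λ _ → refl))) (+-identityʳ _)
  ∑-δʳ {suc m} (suc i) f = trans (+-identityˡ _) (∑-δʳ i (f ∘ suc))

  ∑-antisym : ∀ {m} (a b : Fin m → Carrier) → ∑ (λ p → a p * ∑ (λ q → a q * (b p - b q))) ≈ 0#
  ∑-antisym {m} a b = begin
    ∑ (λ p → a p * ∑ (λ q → a q * (b p - b q)))
      ≈⟨ ∑-cong (λ p → *-distribˡ-∑ (a p) (λ q → a q * (b p - b q))) ⟩
    ∑ (λ p → ∑ (λ q → a p * (a q * (b p - b q))))
      ≈⟨ ∑-cong (λ p → ∑-cong (λ q → expand p q)) ⟩
    ∑ (λ p → ∑ (λ q → T p q - T q p))
      ≈⟨ ∑-cong (λ p → ∑-distrib-- (T p) (λ q → T q p)) ⟩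
    ∑ (λ p → ∑ (T p) - ∑ (λ q → T q p))
      ≈⟨ ∑-distrib-- (λ p → ∑ (T p)) (λ p → ∑ (λ q → T q p)) ⟩
    ∑ (λ p → ∑ (T p)) - ∑ (λ p → ∑ (λ q → T q p))
      ≈⟨ +-congˡ (-‿cong (∑-comm (λ p q → T q p))) ⟩
    ∑ (λ p → ∑ (T p)) - ∑ (λ q → ∑ (T q))
      ≈⟨ -‿inverseʳ _ ⟩
    0# ∎
    where
    T : Fin m → Fin m → Carrier
    T p q = a p * (a q * b p)
    expand : ∀ p q → a p * (a q * (b p - b q)) ≈ T p q - T q p
    expand p q = begin
      a p * (a q * (b p - b q))               ≈⟨ *-congˡ (x[y-z]≈xy-xz (a q) (b p) (b q)) ⟩
      a p * (a q * b p - a q * b q)           ≈⟨ x[y-z]≈xy-xz (a p) _ _ ⟩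
      a p * (a q * b p) - a p * (a q * b q)   ≈⟨ +-congˡ (-‿cong (x∙yz≈y∙xz (a p) (a q) (b q))) ⟩
      T p q - T q p                           ∎

  infixl 6 _⊖_
  _⊖_ : Matrix → Matrix → Matrix
  (A ⊖ B) i j = A i j - B i j

  scalar : Carrier → Matrix
  scalar s i j = if i == j then s else 0#

  ·-congˡ : ∀ {A A′} B → A ≈ₘ A′ → (A · B) ≈ₘ (A′ · B)
  ·-congˡ B A≈A′ i j = ∑-cong (λ t → *-congʳ (A≈A′ i t))

  ·-congʳ : ∀ A {B B′} → B ≈ₘ B′ → (A · B) ≈ₘ (A · B′)
  ·-congʳ A B≈B′ i j = ∑-cong (λ t → *-congˡ (B≈B′ t j))

  ·-assoc : ∀ A B C → ((A · B) · C) ≈ₘ (A · (B · C))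
  ·-assoc A B C i j = begin
    ∑ (λ t → ∑ (λ s → A i s * B s t) * C t j)
      ≈⟨ ∑-cong (λ t → *-distribʳ-∑ (C t j) (λ s → A i s * B s t)) ⟩
    ∑ (λ t → ∑ (λ s → A i s * B s t * C t j))
      ≈⟨ ∑-comm (λ t s → A i s * B s t * C t j) ⟩
    ∑ (λ s → ∑ (λ t → A i s * B s t * C t j))
      ≈⟨ ∑-cong (λ s → ∑-cong (λ t → *-assoc (A i s) (B s t) (C t j))) ⟩
    ∑ (λ s → ∑ (λ t → A i s * (B s t * C t j)))
      ≈⟨ ∑-cong (λ s → sym (*-distribˡ-∑ (A i s) (λ t → B s t * C t j))) ⟩
    ∑ (λ s → A i s * ∑ (λ t → B s t * C t j)) ∎

  ·-distribʳ-⊖ : ∀ A B C → ((A ⊖ B) · C) ≈ₘ ((A · C) ⊖ (B · C))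
  ·-distribʳ-⊖ A B C i j =
    trans (∑-cong (λ t → [y-z]x≈yx-zx (C t j) (A i t) (B i t)))
          (∑-distrib-- (λ t → A i t * C t j) (λ t → B i t * C t j))

  ·-distribˡ-⊖ : ∀ A B C → (C · (A ⊖ B)) ≈ₘ ((C · A) ⊖ (C · B))
  ·-distribˡ-⊖ A B C i j =
    trans (∑-cong (λ t → x[y-z]≈xy-xz (C i t) (A t j) (B t j)))
          (∑-distrib-- (λ t → C i t * A t j) (λ t → C i t * B t j))

  scalar-Commute : ∀ s M → Commute (scalar s) M
  scalar-Commute s M i j = begin
    ∑ (λ t → (if i == t then s else 0#) * M t j)   ≈⟨ ∑-cong (λ t → if-*ʳ (i == t)) ⟩
    ∑ (λ t → if i == t then s * M t j else 0#)     ≈⟨ ∑-δˡ i (λ t → s * M t j) ⟩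
    s * M i j                                       ≈⟨ *-comm s (M i j) ⟩
    M i j * s                                       ≈⟨ ∑-δʳ j (λ t → M i t * s) ⟨
    ∑ (λ t → if t == j then M i t * s else 0#)     ≈⟨ ∑-cong (λ t → if-*ˡ (t == j)) ⟨
    ∑ (λ t → M i t * (if t == j then s else 0#))   ∎
    where
    if-*ʳ : ∀ b {y} → (if b then s else 0#) * y ≈ (if b then s * y else 0#)
    if-*ʳ true  = refl
    if-*ʳ false = zeroˡ _
    if-*ˡ : ∀ b {y} → y * (if b then s else 0#) ≈ (if b then y * s else 0#)
    if-*ˡ true  = refl
    if-*ˡ false = zeroʳ _

  Commute-+* : ∀ M {A B} → Commute M A → Commute M B → ∀ s → Commute M (λ i j → A i j + B i j * s)
  Commute-+* M {A} {B} MA≈AM MB≈BM s i j = begin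
    ∑ (λ t → M i t * (A t j + B t j * s))
      ≈⟨ ∑-cong {n} (λ t → trans (distribˡ _ _ _) (+-congˡ (sym (*-assoc _ _ _)))) ⟩
    ∑ (λ t → M i t * A t j + M i t * B t j * s)
      ≈⟨ ∑-distrib-+ (λ t → M i t * A t j) (λ t → M i t * B t j * s) ⟩
    (M · A) i j + ∑ (λ t → M i t * B t j * s)
      ≈⟨ +-congˡ (*-distribʳ-∑ s (λ t → M i t * B t j)) ⟨
    (M · A) i j + (M · B) i j * s
      ≈⟨ +-cong (MA≈AM i j) (*-congʳ (MB≈BM i j)) ⟩
    (A · M) i j + (B · M) i j * s
      ≈⟨ +-congˡ (*-distribʳ-∑ s (λ t → B i t * M t j)) ⟩
    (A · M) i j + ∑ (λ t → B i t * M t j * s)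
      ≈⟨ ∑-distrib-+ (λ t → A i t * M t j) (λ t → B i t * M t j * s) ⟨
    ∑ (λ t → A i t * M t j + B i t * M t j * s)
      ≈⟨ ∑-cong {n} (λ t → trans (+-congˡ (xy∙z≈xz∙y (B i t) (M t j) s)) (sym (distribʳ _ _ _))) ⟩
    ∑ (λ t → (A i t + B i t * s) * M t j) ∎

module Commutant {c ℓ} (R : CommutativeRing c ℓ) (n : ℕ)
                 (Arc : Fin n → Fin n → Bool) (w : Fin n → Fin n → CommutativeRing.Carrier R) where
  open CommutativeRing R using (Carrier; setoid; sym; +-cong; -‿cong)
  open Digraph R n Arc w
  open MatrixAlgebra R n Arc w

  matrixSetoid : Setoid c ℓ
  matrixSetoid = VecSetoid.≋-setoid (VecSetoid.≋-setoid setoid n) n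

  open SetoidReasoning matrixSetoid

  Commute-sym : ∀ {A B} → Commute A B → Commute B A
  Commute-sym AB≈BA i j = sym (AB≈BA i j)

  Commute-respˡ : ∀ {A A′} M → A ≈ₘ A′ → Commute A′ M → Commute A M
  Commute-respˡ {A} {A′} M A≈A′ A′M≈MA′ = begin
    A · M   ≈⟨ ·-congˡ M A≈A′ ⟩
    A′ · M  ≈⟨ A′M≈MA′ ⟩
    M · A′  ≈⟨ ·-congʳ M A≈A′ ⟨
    M · A   ∎

  Commute-⊖ : ∀ {A B} M → Commute A M → Commute B M → Commute (A ⊖ B) M
  Commute-⊖ {A} {B} M AM≈MA BM≈MB = begin
    (A ⊖ B) · M          ≈⟨ ·-distribʳ-⊖ A B M ⟩
    (A · M) ⊖ (B · M)    ≈⟨ (λ i j → +-cong (AM≈MA i j) (-‿cong (BM≈MB i j))) ⟩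
    (M · A) ⊖ (M · B)    ≈⟨ ·-distribˡ-⊖ A B M ⟨
    M · (A ⊖ B)          ∎

  Commute-· : ∀ {A B} M → Commute A M → Commute B M → Commute (A · B) M
  Commute-· {A} {B} M AM≈MA BM≈MB = begin
    (A · B) · M   ≈⟨ ·-assoc A B M ⟩
    A · (B · M)   ≈⟨ ·-congʳ A BM≈MB ⟩
    A · (M · B)   ≈⟨ ·-assoc A M B ⟨
    (A · M) · B   ≈⟨ ·-congˡ B AM≈MA ⟩
    (M · A) · B   ≈⟨ ·-assoc M A B ⟩
    M · (A · B)   ∎

  -- The partial sums defining Qτ are local to Defs and cannot be named, so
  -- after abstracting over their length the induction motive is left to unification.
  Commute-Qτ : ∀ A → (∀ m → Commute A (Q m)) → ∀ τ → Commute A (Qτ τ)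
  Commute-Qτ A AQ≈QA τ with n ∸ d | rec _ (λ { zero    _  → AQ≈QA 0
                                          ; (suc m) ih → Commute-+* A ih (AQ≈QA (suc m)) (pow τ (suc m)) })
  ... | len | partialSums = partialSums len

  Commute-recurrence : ∀ {A M} (P : ℕ → Matrix) (s : ℕ → Carrier) →
                       P 0 ≈ₘ scalar (s 0) → (∀ k → P (suc k) ≈ₘ (scalar (s (suc k)) ⊖ (A · P k))) →
                       Commute A M → ∀ k → Commute (P k) M
  Commute-recurrence {A} {M} P s P₀ Pₛ AM≈MA zero    = Commute-respˡ M P₀ (scalar-Commute (s 0) M)
  Commute-recurrence {A} {M} P s P₀ Pₛ AM≈MA (suc k) = Commute-respˡ M (Pₛ k)
    (Commute-⊖ M (scalar-Commute (s (suc k)) M) (Commute-· M AM≈MA (Commute-recurrence P s P₀ Pₛ AM≈MA k)))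

module Forests {c ℓ} (R : CommutativeRing c ℓ) (n′ : ℕ)
               (Arc : Fin (suc n′) → Fin (suc n′) → Bool)
               (w : Fin (suc n′) → Fin (suc n′) → CommutativeRing.Carrier R) where
  open Digraph R (suc n′) Arc w

  Vertex : Set
  Vertex = Fin (suc n′)

  step : Parent → Vertex → Vertex
  step f x = fromMaybe x (f x)

  data Reaches (f : Parent) : Vertex → Vertex → Set where
    here  : ∀ {r} → f r ≡ nothing → Reaches f r r
    there : ∀ {x y r} → f x ≡ just y → Reaches f y r → Reaches f x r

  roots : Parent → Vertex → Maybe Vertex
  roots f = walk f (suc n′)

  Forest : Parent → Set
  Forest f = ∀ x → arcOK x (f x) ≡ true × ∃ (Reaches f x)

  nothing≢just : ∀ {x : Vertex} → nothing ≢ just x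
  nothing≢just ()

  Reaches-isRoot : ∀ {f x r} → Reaches f x r → f r ≡ nothing
  Reaches-isRoot (here fr)    = fr
  Reaches-isRoot (there _ yr) = Reaches-isRoot yr

  iterate-parent : ∀ f {x y} → f x ≡ just y → ∀ t → iterate (step f) x (suc t) ≡ iterate (step f) y t
  iterate-parent f {x} fx t = ≡.cong (λ z → iterate (step f) z t) (≡.cong (fromMaybe x) fx)

  iterate-root : ∀ f {x} → f x ≡ nothing → ∀ t → iterate (step f) x t ≡ x
  iterate-root f {x} fx = iterate-fixed (≡.cong (fromMaybe x) fx)

  Reaches⇒iterate : ∀ {f x r} → Reaches f x r → ∃[ t ] iterate (step f) x t ≡ r
  Reaches⇒iterate (here _)      = 0 , ≡.refl
  Reaches⇒iterate {f} (there fx yr) =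
    let t , yt≡r = Reaches⇒iterate yr in suc t , ≡.trans (iterate-parent f fx t) yt≡r

  -- A root that is reached at all is reached within n′ steps, so the fuel of `roots` suffices.
  Reaches-within : ∀ {f x r} → Reaches f x r → iterate (step f) x n′ ≡ r
  Reaches-within {f} {x} {r} xr with Reaches⇒iterate xr
  ... | t , xt≡r with iterate-early (step f) x t
  ...   | s , s<N , xs≡xt = begin
    iterate (step f) x n′
      ≡⟨ ≡.cong (iterate (step f) x) (m+[n∸m]≡n (m<1+n⇒m≤n s<N)) ⟨
    iterate (step f) x (s ℕ.+ (n′ ∸ s))
      ≡⟨ iterate-+ (step f) x s (n′ ∸ s) ⟩
    iterate (step f) (iterate (step f) x s) (n′ ∸ s)
      ≡⟨ ≡.cong (λ y → iterate (step f) y (n′ ∸ s)) (≡.trans xs≡xt xt≡r) ⟩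
    iterate (step f) r (n′ ∸ s)
      ≡⟨ iterate-root f (Reaches-isRoot xr) (n′ ∸ s) ⟩
    r ∎
    where open ≡.≡-Reasoning

  walk-root : ∀ f m x → f (iterate (step f) x m) ≡ nothing → walk f (suc m) x ≡ just (iterate (step f) x m)
  walk-root f zero    x root rewrite root = ≡.refl
  walk-root f (suc m) x root with f x in fx
  ... | nothing = ≡.cong just (≡.sym (iterate-root f fx m))
  ... | just y  = walk-root f m y root

  Reaches⇒roots : ∀ {f x r} → Reaches f x r → roots f x ≡ just r
  Reaches⇒roots {f} {x} {r} xr =
    ≡.trans (walk-root f n′ x (≡.subst (λ z → f z ≡ nothing) (≡.sym within) (Reaches-isRoot xr)))
            (≡.cong just within)
    where
    within : iterate (step f) x n′ ≡ r
    within = Reaches-within xr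

  walk⇒Reaches : ∀ f m {x r} → walk f m x ≡ just r → Reaches f x r
  walk⇒Reaches f (suc m) {x} eq with f x in fx
  ... | nothing = ≡.subst (Reaches f x) (just-injective eq) (here fx)
  ... | just y  = there fx (walk⇒Reaches f m eq)

  allB-suc : ∀ {m} (p : Fin (suc m) → Bool) → allB p ≡ p zero ∧ allB (p ∘ suc)
  allB-suc p = foldr-allFin-suc (λ i b → p i ∧ b) true

  allB⇒ : ∀ {m} (p : Fin m → Bool) → allB p ≡ true → ∀ i → p i ≡ true
  allB⇒ {suc m} p all i with p zero in p₀ | ≡.trans (≡.sym (allB-suc p)) all
  allB⇒ {suc m} p all zero    | true | _    = p₀
  allB⇒ {suc m} p all (suc i) | true | rest = allB⇒ (p ∘ suc) rest i

  ⇒allB : ∀ {m} (p : Fin m → Bool) → (∀ i → p i ≡ true) → allB p ≡ true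
  ⇒allB {zero}  p all = ≡.refl
  ⇒allB {suc m} p all = ≡.trans (allB-suc p) (≡.cong₂ _∧_ (all zero) (⇒allB (p ∘ suc) (all ∘ suc)))

  isInForest⇒Forest : ∀ {f} → isInForest f ≡ true → Forest f
  isInForest⇒Forest {f} isF x
    with arcOK x (f x) | walk f (suc n′) x in rx | allB⇒ (λ i → arcOK i (f i) ∧ is-just (walk f (suc n′) i)) isF x
  ... | true | just r  | _ = ≡.refl , r , walk⇒Reaches f (suc n′) rx
  ... | true | nothing | ()
  ... | false | _      | ()

  Forest⇒isInForest : ∀ {f} → Forest f → isInForest f ≡ true
  Forest⇒isInForest {f} F = ⇒allB _ λ x →
    ≡.cong₂ _∧_ (proj₁ (F x)) (≡.cong is-just (Reaches⇒roots (proj₂ (proj₂ (F x)))))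

  graftRoots : Parent → Vertex → Vertex → Vertex → Maybe Vertex
  graftRoots h i p x = if eqM (roots h x) i then roots h p else roots h x

  module Graft {h h′ : Parent} {i p : Vertex} (hᵢ : h i ≡ nothing) (h′ᵢ : h′ i ≡ just p)
               (h′≡h : ∀ {x} → i ≢ x → h′ x ≡ h x) where

    i≢parent : ∀ {x y} → h x ≡ just y → i ≢ x
    i≢parent hx ≡.refl = nothing≢just (≡.trans (≡.sym hᵢ) hx)

    h′-parent : ∀ {x y} → h x ≡ just y → h′ x ≡ just y
    h′-parent hx = ≡.trans (h′≡h (i≢parent hx)) hx

    Reaches-graft-avoiding : ∀ {x r} → Reaches h x r → i ≢ r → Reaches h′ x r
    Reaches-graft-avoiding (here hr)     i≢r = here (≡.trans (h′≡h i≢r) hr)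
    Reaches-graft-avoiding (there hx yr) i≢r = there (h′-parent hx) (Reaches-graft-avoiding yr i≢r)

    Reaches-graft-through : ∀ {x r} → Reaches h x i → Reaches h′ p r → Reaches h′ x r
    Reaches-graft-through (here _)      pr = there h′ᵢ pr
    Reaches-graft-through (there hx yi) pr = there (h′-parent hx) (Reaches-graft-through yi pr)

    graft-cycle : ∀ {x r} → Reaches h p i → Reaches h x i → ¬ Reaches h′ x r
    graft-cycle pi (here _)       (here h′i)       = nothing≢just (≡.trans (≡.sym h′i) h′ᵢ)
    graft-cycle pi (there hx _)   (here h′x)       = nothing≢just (≡.trans (≡.sym h′x) (h′-parent hx))
    graft-cycle pi (here _)       (there h′i pr)   with just-injective (≡.trans (≡.sym h′ᵢ) h′i)
    ... | ≡.refl = graft-cycle pi pi pr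
    graft-cycle pi (there hx yi)  (there h′x y′r) with just-injective (≡.trans (≡.sym (h′-parent hx)) h′x)
    ... | ≡.refl = graft-cycle pi yi y′r

    Reaches-ungraft : ∀ {x r} → Reaches h′ x r → ∃ (Reaches h x)
    Reaches-ungraft {x} h′x with i ≟ x
    ... | yes ≡.refl = i , here hᵢ
    Reaches-ungraft (here h′r)      | no i≢r = _ , here (≡.trans (≡.sym (h′≡h i≢r)) h′r)
    Reaches-ungraft (there h′x yr)  | no i≢x =
      let r , yr′ = Reaches-ungraft yr in r , there (≡.trans (≡.sym (h′≡h i≢x)) h′x) yr′

    Forest-ungraft : Forest h′ → Forest h
    Forest-ungraft F′ x = arcOK-h , Reaches-ungraft (proj₂ (proj₂ (F′ x)))
      where
      arcOK-h : arcOK x (h x) ≡ true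
      arcOK-h with i ≟ x
      ... | yes ≡.refl = ≡.cong (arcOK i) hᵢ
      ... | no  i≢x    = ≡.trans (≡.cong (arcOK x) (≡.sym (h′≡h i≢x))) (proj₁ (F′ x))

    Forest-graft⇒ : Forest h′ → Arc i p ≡ true × ¬ Reaches h p i
    Forest-graft⇒ F′ = ≡.trans (≡.cong (arcOK i) (≡.sym h′ᵢ)) (proj₁ (F′ i))
                     , λ pi → graft-cycle pi pi (proj₂ (proj₂ (F′ p)))

    module _ (F : Forest h) (¬pi : ¬ Reaches h p i) where
      root-of-p : Vertex
      root-of-p = proj₁ (proj₂ (F p))

      p-reaches : Reaches h p root-of-p
      p-reaches = proj₂ (proj₂ (F p))

      i≢root-of-p : i ≢ root-of-p
      i≢root-of-p ≡.refl = ¬pi p-reaches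

      Forest-graft⇐ : Arc i p ≡ true → Forest h′
      Forest-graft⇐ arc x = arcOK-h′ , reaches-h′
        where
        arcOK-h′ : arcOK x (h′ x) ≡ true
        arcOK-h′ with i ≟ x
        ... | yes ≡.refl = ≡.trans (≡.cong (arcOK i) h′ᵢ) arc
        ... | no  i≢x    = ≡.trans (≡.cong (arcOK x) (h′≡h i≢x)) (proj₁ (F x))
        reaches-h′ : ∃ (Reaches h′ x)
        reaches-h′ with proj₂ (F x)
        ... | r , xr with i ≟ r
        ...   | yes ≡.refl = root-of-p , Reaches-graft-through xr (Reaches-graft-avoiding p-reaches i≢root-of-p)
        ...   | no  i≢r    = r , Reaches-graft-avoiding xr i≢r

      graft-roots : ∀ x → roots h′ x ≡ graftRoots h i p x
      graft-roots x with proj₂ (F x)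
      ... | r , xr rewrite Reaches⇒roots xr | Reaches⇒roots p-reaches with r ≟ i
      ...   | yes ≡.refl = Reaches⇒roots (Reaches-graft-through xr (Reaches-graft-avoiding p-reaches i≢root-of-p))
      ...   | no  r≢i    = Reaches⇒roots (Reaches-graft-avoiding xr (r≢i ∘ ≡.sym))

module ForestSums {c ℓ} (R : CommutativeRing c ℓ) (n′ : ℕ)
                  (Arc : Fin (suc n′) → Fin (suc n′) → Bool)
                  (w : Fin (suc n′) → Fin (suc n′) → CommutativeRing.Carrier R) where
  open CommutativeRing R hiding (zero)
  open RingListSum ring
  open Digraph R (suc n′) Arc w
  open MatrixAlgebra R (suc n′) Arc w
  open Forests R n′ Arc w
  open SetoidReasoning setoid
  open import Algebra.Properties.CommutativeSemigroup *-commutativeSemigroup using (xy∙z≈zy∙x; x∙yz≈y∙xz)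
  open import Algebra.Properties.Ring ring using (x[y-z]≈xy-xz)

  ⟦_⟧ : Bool → Carrier
  ⟦ b ⟧ = if b then 1# else 0#

  RootMap : Set
  RootMap = Vertex → Maybe Vertex

  parentChoices : List (Maybe Vertex)
  parentChoices = nothing ∷ map just (allFin (suc n′))

  ∑ᴾ : ∀ m → (Vector (Maybe Vertex) m → Carrier) → Carrier
  ∑ᴾ m G = ∑ˡ (allFuns parentChoices m) G

  forestWeight : ℕ → Parent → Carrier
  forestWeight k f = if isInForest f then (if eqℕ (numArcs f) k then weight f else 0#) else 0#

  forestSum : ℕ → (RootMap → Carrier) → Carrier
  forestSum k Φ = ∑ᴾ (suc n′) (λ f → forestWeight k f * Φ (roots f))

  ∑ᴾ-insert : ∀ {m} (i : Fin (suc m)) G →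
              ∑ᴾ (suc m) G ≈ ∑ᴾ m (λ g → G (insert g i nothing))
                           + ∑ (λ p → ∑ᴾ m (λ g → G (insert g i (just p))))
  ∑ᴾ-insert {m} i G = trans (∑ˡ-allFuns-insert parentChoices m i G) (+-congˡ (reflexive (≡.trans
    (∑ˡ-map just (allFin (suc n′)) (λ v → ∑ᴾ m (λ g → G (insert g i v))))
    (≡.sym (∑≡∑ˡ (λ p → ∑ᴾ m (λ g → G (insert g i (just p)))))))))

  countB-suc : ∀ {m} (q : Fin (suc m) → Bool) →
               countB q ≡ (if q zero then suc (countB (q ∘ suc)) else countB (q ∘ suc))
  countB-suc q = foldr-allFin-suc (λ i k → if q i then suc k else k) zero

  countB-graft : ∀ {m} (g : Vector (Maybe Vertex) m) i p →
                 countB (λ x → is-just (insert g i (just p) x)) ≡ suc (countB (λ x → is-just (insert g i nothing x)))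
  countB-graft g zero p = ≡.trans (countB-suc (λ x → is-just (insert g zero (just p) x)))
                                  (≡.cong suc (≡.sym (countB-suc (λ x → is-just (insert g zero nothing x)))))
  countB-graft {suc m} g (suc i) p
    rewrite countB-suc (λ x → is-just (insert g (suc i) (just p) x))
          | countB-suc (λ x → is-just (insert g (suc i) nothing x))
          | countB-graft (tail g) i p
    with is-just (head g)
  ... | true  = ≡.refl
  ... | false = ≡.refl

  ∏-insert : ∀ {a} {A : Set a} {m} (f : Fin (suc m) → A → Carrier) (g : Vector A m) i u v →
             ∏ (λ x → f x (insert g i u x)) * f i v ≈ ∏ (λ x → f x (insert g i v x)) * f i u
  ∏-insert f g zero u v = xy∙z≈zy∙x (f zero u) _ (f zero v)
  ∏-insert {m = suc m} f g (suc i) u v = begin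
    f zero (head g) * P u * f (suc i) v   ≈⟨ *-assoc _ _ _ ⟩
    f zero (head g) * (P u * f (suc i) v) ≈⟨ *-congˡ (∏-insert (f ∘ suc) (tail g) i u v) ⟩
    f zero (head g) * (P v * f (suc i) u) ≈⟨ *-assoc _ _ _ ⟨
    f zero (head g) * P v * f (suc i) u   ∎
    where
    P : _ → Carrier
    P v = ∏ (λ x → f (suc x) (insert (tail g) i v x))

  weight-graft : ∀ (g : Vector (Maybe Vertex) n′) i p →
                 weight (insert g i (just p)) ≈ weight (insert g i nothing) * w i p
  weight-graft g i p = trans (sym (*-identityʳ _)) (∏-insert arcWeight g i (just p) nothing)

  module AtVertex (i : Vertex) where
    rooted : Vector (Maybe Vertex) n′ → Parent
    rooted g = insert g i nothing

    grafted : Vector (Maybe Vertex) n′ → Vertex → Parent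
    grafted g p = insert g i (just p)

    outArc : Parent → Vertex → Carrier
    outArc h p = W i p * ⟦ not (eqM (roots h p) i) ⟧

    predWeight : ℕ → Parent → Carrier
    predWeight zero    h = 0#
    predWeight (suc k) h = forestWeight k h

    predWeight-nonforest : ∀ k {h} → isInForest h ≡ false → predWeight k h ≡ 0#
    predWeight-nonforest zero    _    = ≡.refl
    predWeight-nonforest (suc k) notF rewrite notF = ≡.refl

    roots-rooted : ∀ g → roots (rooted g) i ≡ just i
    roots-rooted g = Reaches⇒roots {rooted g} (here (insert-lookup g i nothing))

    module _ (g : Vector (Maybe Vertex) n′) (p : Vertex) where
      open Graft {rooted g} {grafted g p}
                 (insert-lookup g i nothing) (insert-lookup g i (just p)) (insert-other g (just p) nothing)

      private
        h h′ : Parent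
        h  = rooted g
        h′ = grafted g p

      outside-tree : Forest h → ¬ Reaches h p i → eqM (roots h p) i ≡ false
      outside-tree F ¬pi rewrite Reaches⇒roots (p-reaches F ¬pi) =
        dec-false (root-of-p F ¬pi ≟ i) (i≢root-of-p F ¬pi ∘ ≡.sym)

      inside-tree : eqM (roots h p) i ≡ false → ¬ Reaches h p i
      inside-tree notIn pi =
        not-¬ (dec-true (i ≟ i) ≡.refl) (≡.trans (≡.cong (λ r → eqM r i) (≡.sym (Reaches⇒roots pi))) notIn)

      isInForest-graft : isInForest h′ ≡ isInForest h ∧ (Arc i p ∧ not (eqM (roots h p) i))
      isInForest-graft with isInForest h′ in isF′
      ... | true = let F′ = isInForest⇒Forest isF′ ; F = Forest-ungraft F′ ; arc , ¬pi = Forest-graft⇒ F′ in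
        ≡.sym (≡.cong₂ _∧_ (Forest⇒isInForest F) (≡.cong₂ _∧_ arc (≡.cong not (outside-tree F ¬pi))))
      ... | false with isInForest h in isF | Arc i p in arc | eqM (roots h p) i in inTree
      ...   | true  | true  | false =
        ⊥-elim (not-¬ (Forest⇒isInForest (Forest-graft⇐ (isInForest⇒Forest isF) (inside-tree inTree) arc)) isF′)
      ...   | false | _     | _     = ≡.refl
      ...   | true  | false | _     = ≡.refl
      ...   | true  | true  | true  = ≡.refl

      numArcs-graft : numArcs h′ ≡ suc (numArcs h)
      numArcs-graft = countB-graft g i p

      graft-weight-forest : isInForest h ≡ true → ∀ k →
                            (if eqℕ (numArcs h′) k then weight h′ else 0#) ≈ predWeight k h * (w i p * 1#)
      graft-weight-forest isF zero    rewrite numArcs-graft = sym (zeroˡ _)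
      graft-weight-forest isF (suc k) rewrite numArcs-graft | isF with eqℕ (numArcs h) k
      ... | true  = trans (weight-graft g i p) (*-congˡ (sym (*-identityʳ _)))
      ... | false = sym (zeroˡ _)

      graft-weight : ∀ k → forestWeight k h′ ≈ predWeight k h * outArc h p
      graft-weight k rewrite isInForest-graft with isInForest h in isF | Arc i p | eqM (roots h p) i
      ... | false | _     | _     = sym (trans (*-congʳ (reflexive (predWeight-nonforest k isF))) (zeroˡ _))
      ... | true  | false | _     = sym (trans (*-congˡ (zeroˡ _)) (zeroʳ _))
      ... | true  | true  | true  = sym (trans (*-congˡ (zeroʳ _)) (zeroʳ _))
      ... | true  | true  | false = graft-weight-forest isF k

      graft-term : ∀ k Φ → Φ Preserves _≗_ ⟶ _≈_ →
                   forestWeight k h′ * Φ (roots h′) ≈ predWeight k h * (outArc h p * Φ (graftRoots h i p))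
      graft-term k Φ ext = begin
        forestWeight k h′ * Φ (roots h′)                      ≈⟨ reroot ⟩
        forestWeight k h′ * Φ (graftRoots h i p)              ≈⟨ *-congʳ (graft-weight k) ⟩
        predWeight k h * outArc h p * Φ (graftRoots h i p)    ≈⟨ *-assoc _ _ _ ⟩
        predWeight k h * (outArc h p * Φ (graftRoots h i p))  ∎
        where
        reroot : forestWeight k h′ * Φ (roots h′) ≈ forestWeight k h′ * Φ (graftRoots h i p)
        reroot with isInForest h′ in isF′
        ... | false = trans (zeroˡ _) (sym (zeroˡ _))
        ... | true  = let F′ = isInForest⇒Forest isF′ in
          *-congˡ (ext (graft-roots (Forest-ungraft F′) (proj₂ (Forest-graft⇒ F′))))

    rootPart : ℕ → (RootMap → Carrier) → Carrier
    rootPart k Φ = ∑ᴾ n′ (λ g → forestWeight k (rooted g) * Φ (roots (rooted g)))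

    graftPart : ℕ → (RootMap → Carrier) → Carrier
    graftPart k Φ =
      ∑ᴾ n′ (λ g → predWeight k (rooted g) * ∑ (λ p → outArc (rooted g) p * Φ (graftRoots (rooted g) i p)))

    forestSum-split : ∀ k Φ → Φ Preserves _≗_ ⟶ _≈_ → forestSum k Φ ≈ rootPart k Φ + graftPart k Φ
    forestSum-split k Φ ext = trans (∑ᴾ-insert i _) (+-congˡ (begin
      ∑ (λ p → ∑ᴾ n′ (λ g → forestWeight k (grafted g p) * Φ (roots (grafted g p))))
        ≈⟨ ∑-cong (λ p → ∑ˡ-cong (allFuns parentChoices n′) (λ g → graft-term g p k Φ ext)) ⟩
      ∑ (λ p → ∑ᴾ n′ (λ g → predWeight k (rooted g) * (outArc (rooted g) p * Φ (graftRoots (rooted g) i p))))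
        ≈⟨ ∑-∑ˡ-comm (allFuns parentChoices n′) (λ p g →
             predWeight k (rooted g) * (outArc (rooted g) p * Φ (graftRoots (rooted g) i p))) ⟩
      ∑ᴾ n′ (λ g → ∑ (λ p → predWeight k (rooted g) * (outArc (rooted g) p * Φ (graftRoots (rooted g) i p))))
        ≈⟨ ∑ˡ-cong (allFuns parentChoices n′) (λ g → *-distribˡ-∑ (predWeight k (rooted g)) λ p →
             outArc (rooted g) p * Φ (graftRoots (rooted g) i p)) ⟨
      graftPart k Φ ∎))

  forestSum-cong : ∀ k {Φ Ψ} → (∀ r → Φ r ≈ Ψ r) → forestSum k Φ ≈ forestSum k Ψ
  forestSum-cong k Φ≈Ψ = ∑ˡ-cong allParents (λ f → *-congˡ (Φ≈Ψ (roots f)))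

  forestSum-distrib-- : ∀ k Φ Ψ → forestSum k (λ r → Φ r - Ψ r) ≈ forestSum k Φ - forestSum k Ψ
  forestSum-distrib-- k Φ Ψ =
    trans (∑ˡ-cong allParents (λ f → x[y-z]≈xy-xz (forestWeight k f) _ _))
          (∑ˡ-distrib-- allParents (λ f → forestWeight k f * Φ (roots f)) (λ f → forestWeight k f * Ψ (roots f)))

  *-distribˡ-forestSum : ∀ k s Φ → s * forestSum k Φ ≈ forestSum k (λ r → s * Φ r)
  *-distribˡ-forestSum k s Φ =
    trans (*-distribˡ-∑ˡ allParents s (λ f → forestWeight k f * Φ (roots f)))
          (∑ˡ-cong allParents (λ f → x∙yz≈y∙xz s (forestWeight k f) _))

  ∑-forestSum : ∀ {m} k (Φ : Fin m → RootMap → Carrier) →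
                ∑ (λ x → forestSum k (Φ x)) ≈ forestSum k (λ r → ∑ (λ x → Φ x r))
  ∑-forestSum k Φ = trans (∑-∑ˡ-comm allParents (λ x f → forestWeight k f * Φ x (roots f)))
                          (∑ˡ-cong allParents (λ f → sym (*-distribˡ-∑ (forestWeight k f) (λ x → Φ x (roots f)))))

module Recurrence {c ℓ} (R : CommutativeRing c ℓ) (n′ : ℕ)
                  (Arc : Fin (suc n′) → Fin (suc n′) → Bool) (noLoop : ∀ i → Arc i i ≡ false)
                  (w : Fin (suc n′) → Fin (suc n′) → CommutativeRing.Carrier R) where
  open CommutativeRing R hiding (zero)
  open import Algebra.Properties.Ring ring using (x[y-z]≈xy-xz; -‿distribˡ-*; -0#≈0#; ⁻¹-anti-homo‿-; xyx⁻¹≈y)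
  open import Data.Bool.Properties using () renaming (_≟_ to _≟ᵇ_)
  open RingListSum ring
  open Digraph R (suc n′) Arc w
  open MatrixAlgebra R (suc n′) Arc w
  open Forests R n′ Arc w
  open ForestSums R n′ Arc w
  open SetoidReasoning setoid

  σ : ℕ → Carrier
  σ k = forestSum k (λ _ → 1#)

  rootIs : Vertex → Vertex → RootMap → Carrier
  rootIs x j r = ⟦ eqM (r x) j ⟧

  rootIs-extensional : ∀ x j → rootIs x j Preserves _≗_ ⟶ _≈_
  rootIs-extensional x j r≗r′ = reflexive (≡.cong (λ r → ⟦ eqM r j ⟧) (r≗r′ x))

  Q-forestSum : ∀ k i j → Q k i j ≈ forestSum k (rootIs i j)
  Q-forestSum k i j = trans (∑ˡ-filter (λ f → isInForest f ≟ᵇ true) allParents _) (∑ˡ-cong allParents entry)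
    where
    entry : ∀ f → (if does (isInForest f ≟ᵇ true)
                   then (if eqℕ (numArcs f) k ∧ eqM (walk f (suc n′) i) j then weight f else 0#)
                   else 0#)
                  ≈ forestWeight k f * rootIs i j (roots f)
    entry f with isInForest f | eqℕ (numArcs f) k | eqM (walk f (suc n′) i) j
    ... | false | _     | _     = sym (zeroˡ _)
    ... | true  | false | _     = sym (zeroˡ _)
    ... | true  | true  | true  = sym (*-identityʳ _)
    ... | true  | true  | false = sym (zeroʳ _)

  L-difference : ∀ i (X : Vertex → Carrier) → ∑ (λ m → L i m * X m) ≈ ∑ (λ m → W i m * (X i - X m))
  L-difference i X = begin
    ∑ (λ m → L i m * X m)
      ≈⟨ ∑-cong entry ⟩
    ∑ (λ m → (if i == m then outdeg * X m else 0#) - W i m * X m)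
      ≈⟨ ∑-distrib-- (λ m → if i == m then outdeg * X m else 0#) (λ m → W i m * X m) ⟩
    ∑ (λ m → if i == m then outdeg * X m else 0#) - ∑ (λ m → W i m * X m)
      ≈⟨ +-congʳ (∑-δˡ i (λ m → outdeg * X m)) ⟩
    outdeg * X i - ∑ (λ m → W i m * X m)
      ≈⟨ +-congʳ (*-distribʳ-∑ (X i) (W i)) ⟩
    ∑ (λ m → W i m * X i) - ∑ (λ m → W i m * X m)
      ≈⟨ ∑-distrib-- (λ m → W i m * X i) (λ m → W i m * X m) ⟨
    ∑ (λ m → W i m * X i - W i m * X m)
      ≈⟨ ∑-cong (λ m → x[y-z]≈xy-xz (W i m) (X i) (X m)) ⟨
    ∑ (λ m → W i m * (X i - X m)) ∎
    where
    outdeg : Carrier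
    outdeg = ∑ (W i)
    Wᵢᵢ≈0 : W i i ≈ 0#
    Wᵢᵢ≈0 rewrite noLoop i = refl
    Lᵢᵢ≈outdeg : ∑ (λ k → if k == i then 0# else W i k) ≈ outdeg
    Lᵢᵢ≈outdeg = ∑-cong λ k → loop k
      where
      loop : ∀ k → (if k == i then 0# else W i k) ≈ W i k
      loop k with k ≟ i
      ... | yes ≡.refl = sym Wᵢᵢ≈0
      ... | no  _      = refl
    entry : ∀ m → L i m * X m ≈ (if i == m then outdeg * X m else 0#) - W i m * X m
    entry m with i ≟ m
    ... | yes ≡.refl = begin
      _ * X i                 ≈⟨ *-congʳ Lᵢᵢ≈outdeg ⟩
      outdeg * X i            ≈⟨ +-identityʳ _ ⟨
      outdeg * X i + 0#       ≈⟨ +-congˡ (trans (-‿cong (trans (*-congʳ Wᵢᵢ≈0) (zeroˡ _))) -0#≈0#) ⟨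
      outdeg * X i - W i i * X i ∎
    ... | no  _      = trans (sym (-‿distribˡ-* (W i m) (X m))) (sym (+-identityˡ _))

  LrootIs : Vertex → Vertex → RootMap → Carrier
  LrootIs i j r = ∑ (λ m → W i m * (rootIs i j r - rootIs m j r))

  LQ-forestSum : ∀ k i j → (L · Q k) i j ≈ forestSum k (LrootIs i j)
  LQ-forestSum k i j = begin
    ∑ (λ m → L i m * Q k m j)
      ≈⟨ ∑-cong {suc n′} (λ m → *-congˡ {L i m} (Q-forestSum k m j)) ⟩
    ∑ (λ m → L i m * X m)
      ≈⟨ L-difference i X ⟩
    ∑ (λ m → W i m * (X i - X m))
      ≈⟨ ∑-cong {suc n′} (λ m → *-congˡ {W i m} (forestSum-distrib-- k (rootIs i j) (rootIs m j))) ⟨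
    ∑ (λ m → W i m * forestSum k (λ r → rootIs i j r - rootIs m j r))
      ≈⟨ ∑-cong {suc n′} (λ m → *-distribˡ-forestSum k (W i m) (λ r → rootIs i j r - rootIs m j r)) ⟩
    ∑ (λ m → forestSum k (λ r → W i m * (rootIs i j r - rootIs m j r)))
      ≈⟨ ∑-forestSum k (λ m r → W i m * (rootIs i j r - rootIs m j r)) ⟩
    forestSum k (LrootIs i j) ∎
    where
    X : Vertex → Carrier
    X m = forestSum k (rootIs m j)

  LrootIs-extensional : ∀ i j → LrootIs i j Preserves _≗_ ⟶ _≈_
  LrootIs-extensional i j r≗r′ =
    ∑-cong {suc n′} λ m →
      *-congˡ {W i m} (+-cong (rootIs-extensional i j r≗r′) (-‿cong (rootIs-extensional m j r≗r′)))

  ⟦⟧-* : ∀ b s → ⟦ b ⟧ * s ≈ (if b then s else 0#)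
  ⟦⟧-* true  s = *-identityˡ s
  ⟦⟧-* false s = zeroˡ s

  x-[x-y]≈y : ∀ x y → x - (x - y) ≈ y
  x-[x-y]≈y x y = trans (+-congˡ (⁻¹-anti-homo‿- x y)) (trans (sym (+-assoc x y (- x))) (xyx⁻¹≈y x y))

  module AtEntry (i j : Vertex) where
    open AtVertex i

    δ : Carrier
    δ = ⟦ i == j ⟧

    outflow : RootMap → Carrier
    outflow r = ∑ (λ m → W i m * (δ - rootIs m j r))

    rootTerm : ℕ → Carrier
    rootTerm k = ∑ᴾ n′ (λ g → forestWeight k (rooted g) * outflow (roots (rooted g)))

    graftTerm : ℕ → Carrier
    graftTerm k = ∑ᴾ n′ (λ g → predWeight k (rooted g) * outflow (roots (rooted g)))

    rootIs-rooted : ∀ g → rootIs i j (roots (rooted g)) ≡ δ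
    rootIs-rooted g = ≡.cong (λ r → ⟦ eqM r j ⟧) (roots-rooted g)

    rootIs-grafted : ∀ g p → rootIs i j (graftRoots (rooted g) i p) ≡ rootIs p j (roots (rooted g))
    rootIs-grafted g p rewrite roots-rooted g | dec-true (i ≟ i) ≡.refl = ≡.refl

    reroot-difference : ∀ (r s : Maybe Vertex) x →
      x * (⟦ eqM s j ⟧ - ⟦ eqM (if eqM r i then s else r) j ⟧) ≈
      x * ⟦ not (eqM r i) ⟧ * (⟦ eqM s j ⟧ - ⟦ eqM r j ⟧)
    reroot-difference r s x with eqM r i
    ... | true  = trans (*-congˡ (-‿inverseʳ _)) (trans (zeroʳ x) (sym (trans (*-congʳ (zeroʳ x)) (zeroˡ _))))
    ... | false = *-congʳ (sym (*-identityʳ x))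

    outside-difference : ∀ (r : Maybe Vertex) x →
                         x * ⟦ not (eqM r i) ⟧ * (δ - ⟦ eqM r j ⟧) ≈ x * (δ - ⟦ eqM r j ⟧)
    outside-difference nothing  x = *-congʳ (*-identityʳ x)
    outside-difference (just r) x with r ≟ i
    ... | yes ≡.refl = trans (*-congʳ (zeroʳ x)) (trans (zeroˡ _) (sym (trans (*-congˡ (-‿inverseʳ δ)) (zeroʳ x))))
    ... | no  _      = *-congʳ (*-identityʳ x)

    LrootIs-grafted : ∀ g p → LrootIs i j (graftRoots (rooted g) i p) ≈
                      ∑ (λ m → outArc (rooted g) m * (rootIs p j (roots (rooted g)) - rootIs m j (roots (rooted g))))
    LrootIs-grafted g p = ∑-cong {suc n′} λ m →
      trans (*-congˡ {W i m} (+-congʳ (reflexive (rootIs-grafted g p))))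
            (reroot-difference (roots (rooted g) m) (roots (rooted g) p) (W i m))

    LQ≈rootTerm : ∀ k → (L · Q k) i j ≈ rootTerm k
    LQ≈rootTerm k = begin
      (L · Q k) i j
        ≈⟨ LQ-forestSum k i j ⟩
      forestSum k (LrootIs i j)
        ≈⟨ forestSum-split k (LrootIs i j) (LrootIs-extensional i j) ⟩
      rootPart k (LrootIs i j) + graftPart k (LrootIs i j)
        ≈⟨ +-cong (∑ˡ-cong (allFuns parentChoices n′) rooted-outflow) graft-vanishes ⟩
      rootTerm k + 0#
        ≈⟨ +-identityʳ _ ⟩
      rootTerm k ∎
      where
      rooted-outflow : ∀ g → forestWeight k (rooted g) * LrootIs i j (roots (rooted g)) ≈
                             forestWeight k (rooted g) * outflow (roots (rooted g))
      rooted-outflow g = *-congˡ {forestWeight k (rooted g)} (∑-cong {suc n′} λ m →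
        *-congˡ {W i m} (+-congʳ { - rootIs m j (roots (rooted g))} (reflexive (rootIs-rooted g))))
      graft-vanishes : graftPart k (LrootIs i j) ≈ 0#
      graft-vanishes = ∑ˡ-zero (allFuns parentChoices n′) λ g → trans (*-congˡ (cancel g)) (zeroʳ _)
        where
        cancel : ∀ g → ∑ (λ p → outArc (rooted g) p * LrootIs i j (graftRoots (rooted g) i p)) ≈ 0#
        cancel g = begin
          ∑ (λ p → outArc (rooted g) p * LrootIs i j (graftRoots (rooted g) i p))
            ≈⟨ ∑-cong {suc n′} (λ p → *-congˡ {outArc (rooted g) p} (LrootIs-grafted g p)) ⟩
          ∑ (λ p → outArc (rooted g) p * ∑ (λ m → outArc (rooted g) m * (Bⱼ p - Bⱼ m)))
            ≈⟨ ∑-antisym (outArc (rooted g)) Bⱼ ⟩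
          0# ∎
          where
          Bⱼ : Vertex → Carrier
          Bⱼ x = rootIs x j (roots (rooted g))

    σQ≈graftTerm : ∀ k → δ * σ k - Q k i j ≈ graftTerm k
    σQ≈graftTerm k = begin
      δ * σ k - Q k i j
        ≈⟨ +-cong (*-distribˡ-forestSum k δ (λ _ → 1#)) (-‿cong (Q-forestSum k i j)) ⟩
      forestSum k (λ _ → δ * 1#) - forestSum k (rootIs i j)
        ≈⟨ +-congʳ (forestSum-cong k (λ _ → *-identityʳ δ)) ⟩
      forestSum k (λ _ → δ) - forestSum k (rootIs i j)
        ≈⟨ forestSum-distrib-- k (λ _ → δ) (rootIs i j) ⟨
      forestSum k Δ
        ≈⟨ forestSum-split k Δ (λ r≗r′ → +-congˡ (-‿cong (rootIs-extensional i j r≗r′))) ⟩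
      rootPart k Δ + graftPart k Δ
        ≈⟨ +-cong root-vanishes (∑ˡ-cong (allFuns parentChoices n′) grafted-outflow) ⟩
      0# + graftTerm k
        ≈⟨ +-identityˡ _ ⟩
      graftTerm k ∎
      where
      Δ : RootMap → Carrier
      Δ r = δ - rootIs i j r
      root-vanishes : rootPart k Δ ≈ 0#
      root-vanishes = ∑ˡ-zero (allFuns parentChoices n′) λ g →
        trans (*-congˡ (trans (+-congˡ (-‿cong (reflexive (rootIs-rooted g)))) (-‿inverseʳ δ))) (zeroʳ _)
      grafted-outflow : ∀ g →
        predWeight k (rooted g) * ∑ (λ p → outArc (rooted g) p * Δ (graftRoots (rooted g) i p)) ≈
        predWeight k (rooted g) * outflow (roots (rooted g))
      grafted-outflow g = *-congˡ {predWeight k (rooted g)} (∑-cong {suc n′} λ p →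
        trans (*-congˡ {outArc (rooted g) p} (+-congˡ {δ} (-‿cong (reflexive (rootIs-grafted g p)))))
              (outside-difference (roots (rooted g) p) (W i p)))

    graftTerm-zero : graftTerm 0 ≈ 0#
    graftTerm-zero = ∑ˡ-zero (allFuns parentChoices n′) (λ g → zeroˡ _)

  -- The middle step uses that graftTerm (suc k) is rootTerm k by the definition of predWeight.
  Q-recurrence : ∀ k → Q (suc k) ≈ₘ (scalar (σ (suc k)) ⊖ (L · Q k))
  Q-recurrence k i j = begin
    Q (suc k) i j
      ≈⟨ x-[x-y]≈y (δ * σ (suc k)) (Q (suc k) i j) ⟨
    δ * σ (suc k) - (δ * σ (suc k) - Q (suc k) i j)
      ≈⟨ +-cong (⟦⟧-* (i == j) _) (-‿cong (σQ≈graftTerm (suc k))) ⟩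
    scalar (σ (suc k)) i j - graftTerm (suc k)
      ≈⟨ +-congˡ (-‿cong (LQ≈rootTerm k)) ⟨
    scalar (σ (suc k)) i j - (L · Q k) i j ∎
    where open AtEntry i j

  Q-initial : Q 0 ≈ₘ scalar (σ 0)
  Q-initial i j = begin
    Q 0 i j
      ≈⟨ x-[x-y]≈y (δ * σ 0) (Q 0 i j) ⟨
    δ * σ 0 - (δ * σ 0 - Q 0 i j)
      ≈⟨ +-cong (⟦⟧-* (i == j) _) (-‿cong (trans (σQ≈graftTerm 0) graftTerm-zero)) ⟩
    scalar (σ 0) i j - 0#
      ≈⟨ +-congˡ -0#≈0# ⟩
    scalar (σ 0) i j + 0#
      ≈⟨ +-identityʳ _ ⟩
    scalar (σ 0) i j ∎
    where open AtEntry i j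

corollary3 : ∀ {c ℓ : Level} (R : CommutativeRing c ℓ) (n : ℕ) → 1 < n
    → (Arc : Fin n → Fin n → Bool) → (∀ i → Arc i i ≡ false)
    → (w : Fin n → Fin n → CommutativeRing.Carrier R)
    → let open Digraph R n Arc w in
      (k : ℕ)
    → ((M : Matrix) → Commute L M → Commute (Q k) M)
      × Commute (Q k) L
      × (∀ τ → Commute (Q k) (Qτ τ))
      × (∀ m → Commute (Q k) (Q m))
corollary3 R (suc n′) _ Arc noLoop w k = Q-commutes k , Q-commutes-L k , Commute-Qτ (Q k) Q-commutes-Q , Q-commutes-Q
  where
  open CommutativeRing R using (refl)
  open Digraph R (suc n′) Arc w
  open Commutant R (suc n′) Arc w
  open Recurrence R n′ Arc noLoop w using (σ; Q-initial; Q-recurrence)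

  Q-commutes : ∀ k M → Commute L M → Commute (Q k) M
  Q-commutes k M LM≈ML = Commute-recurrence {L} {M} Q σ Q-initial Q-recurrence LM≈ML k

  Q-commutes-L : ∀ k → Commute (Q k) L
  Q-commutes-L k = Q-commutes k L (λ _ _ → refl)

  Q-commutes-Q : ∀ m → Commute (Q k) (Q m)
  Q-commutes-Q m = Q-commutes k (Q m) (Commute-sym {Q m} {L} (Q-commutes-L m))
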